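{- Let $G=(Q+S,E)$ be a split graph, with vertex set partitioned into a clique $Q$ and an independent set $S$, and suppose $G$ has no universal vertex. Then the complete width of $G$ is either $|Q|$ or $|Q|+1$.
   Context: All graphs are finite, simple and undirected. A vertex $v$ is universal if it is adjacent to all other vertices. For a graph $G=(V,E)$, the complete width $cow(G)$ is the minimum $k\ge 0$ such that there exist $k$ independent sets $N_1,\dots,N_k\subseteq V$ with the property that for every two distinct non-adjacent vertices $x,y$ of $G$ there is an $i$ with $x,y\in N_i$. -}

module Defs where

open import Data.Nat using (ℕ; _<_)
open import Data.Bool using (Bool; true; false)
open import Data.Fin using (Fin)
open import Data.Fin.Subset using (Subset; _∈_; _∉_; ∣_∣)
open import Data.Product using (Σ; _×_; ∃)
open import Relation.Binary.PropositionalEquality using (_≡_; _≢_)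
open import Relation.Nullary using (¬_)

record Graph (n : ℕ) : Set where
  field
    adj   : Fin n → Fin n → Bool
    sym   : ∀ x y → adj x y ≡ adj y x
    irrefl : ∀ x → adj x x ≡ false
open Graph public

module _ {n : ℕ} (G : Graph n) where

  Adjacent : Fin n → Fin n → Set
  Adjacent x y = adj G x y ≡ true

  NonAdjacent : Fin n → Fin n → Set
  NonAdjacent x y = adj G x y ≡ false

  Universal : Fin n → Set
  Universal v = ∀ w → w ≢ v → Adjacent v w

  IsClique : Subset n → Set
  IsClique Q = ∀ x y → x ∈ Q → y ∈ Q → x ≢ y → Adjacent x y

  IsIndependent : Subset n → Set
  IsIndependent N = ∀ x y → x ∈ N → y ∈ N → NonAdjacent x y

  IsSplitPartition : Subset n → Set
  IsSplitPartition Q =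
    IsClique Q × (∀ x y → x ∉ Q → y ∉ Q → NonAdjacent x y)

  CompleteWidthCover : ℕ → Set
  CompleteWidthCover k =
    Σ (Fin k → Subset n) λ N →
      (∀ i → IsIndependent (N i)) ×
      (∀ x y → x ≢ y → NonAdjacent x y → ∃ λ i → x ∈ N i × y ∈ N i)

  IsCompleteWidth : ℕ → Set
  IsCompleteWidth k = CompleteWidthCover k × (∀ j → j < k → ¬ CompleteWidthCover j)

-- Every vertex q of the clique Q has a non-neighbour, and a pair {q, w} of non-adjacent
-- vertices has to be covered; an independent set contains at most one vertex of Q, so
-- the pigeonhole principle forces at least |Q| independent sets. Conversely S together
-- with the sets of non-neighbours of the q ∈ Q, which are {q} ∪ (S ∖ N(q)), are |Q| + 1
-- independent sets covering all non-adjacent pairs. Whether |Q| sets suffice is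
-- decidable, since there are only finitely many families of subsets to try.
module Submission where

open import Defs hiding (sym)
open import Data.Nat using (ℕ; suc; zero; _≤_; s≤s⁻¹)
open import Data.Nat.Properties using (≤-antisym; <⇒≱; ≮⇒≥)
open import Data.Bool using (not)
open import Data.Bool.Properties using (not-injective; ¬-not) renaming (_≟_ to _≟ᵇ_)
open import Data.Fin using (Fin; zero; suc; _≟_)
open import Data.Fin.Properties using (any?; all?; ¬∀⟶∃¬; pigeonhole; suc-injective; <⇒≢)
open import Data.Fin.Subset using (Subset; inside; outside; _∈_; _∉_; ∁; ∣_∣)
open import Data.Fin.Subset.Properties using (_∈?_; anySubset?; x∈∁p⇒x∉p; x∉p⇒x∈∁p)
open import Data.Vec using (_∷_; here; there; tabulate)
open import Data.Vec.Properties using (lookup∘tabulate; []=⇒lookup; lookup⇒[]=)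
import Data.Vec.Functional as Vector
open import Data.Product using (Σ; _×_; _,_; ∃; proj₁; proj₂)
open import Data.Sum using (_⊎_; inj₁; inj₂)
open import Function using (_∘_)
open import Function.Definitions using (Injective)
open import Level using (0ℓ)
open import Relation.Binary.Definitions using (_Respects_)
open import Relation.Binary.PropositionalEquality
  using (_≡_; _≢_; _≗_; refl; sym; trans; cong; subst; ≢-sym)
open import Relation.Nullary using (¬_; Dec; yes; no; ¬?; contradiction)
open import Relation.Nullary.Decidable using (map′; _×-dec_; _→-dec_)
open import Relation.Unary using (Pred; Decidable)

enumerate : ∀ {n} (p : Subset n) → Fin ∣ p ∣ → Fin n
enumerate (inside ∷ p) zero = zero
enumerate (inside ∷ p) (suc i) = suc (enumerate p i)
enumerate (outside ∷ p) i = suc (enumerate p i)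

enumerate-∈ : ∀ {n} (p : Subset n) i → enumerate p i ∈ p
enumerate-∈ (inside ∷ p) zero = here
enumerate-∈ (inside ∷ p) (suc i) = there (enumerate-∈ p i)
enumerate-∈ (outside ∷ p) i = there (enumerate-∈ p i)

enumerate-injective : ∀ {n} (p : Subset n) → Injective _≡_ _≡_ (enumerate p)
enumerate-injective (inside ∷ p) {zero} {zero} _ = refl
enumerate-injective (inside ∷ p) {suc i} {suc j} e =
  cong suc (enumerate-injective p (suc-injective e))
enumerate-injective (outside ∷ p) e = enumerate-injective p (suc-injective e)

enumerate-surjective : ∀ {n} (p : Subset n) {x} → x ∈ p → ∃ λ i → enumerate p i ≡ x
enumerate-surjective (inside ∷ p) here = zero , refl
enumerate-surjective (inside ∷ p) (there x∈p)
  with i , e ← enumerate-surjective p x∈p = suc i , cong suc e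
enumerate-surjective (outside ∷ p) (there x∈p)
  with i , e ← enumerate-surjective p x∈p = i , cong suc e

x∈tabulate⁺ : ∀ {n} {f : Fin n → _} {x} → f x ≡ inside → x ∈ tabulate f
x∈tabulate⁺ {f = f} {x} e = lookup⇒[]= x _ (trans (lookup∘tabulate f x) e)

x∈tabulate⁻ : ∀ {n} {f : Fin n → _} {x} → x ∈ tabulate f → f x ≡ inside
x∈tabulate⁻ {f = f} {x} x∈ = trans (sym (lookup∘tabulate f x)) ([]=⇒lookup x∈)

anyVector? : ∀ {A : Set} → (∀ {P : Pred A 0ℓ} → Decidable P → Dec (∃ P)) →
             ∀ k {P : Pred (Vector.Vector A k) 0ℓ} → Decidable P → P Respects _≗_ → Dec (∃ P)
anyVector? anyᴬ? zero P? resp =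
  map′ (λ p → Vector.[] , p) (λ (xs , p) → resp (λ ()) p) (P? Vector.[])
anyVector? anyᴬ? (suc k) P? resp =
  map′ (λ (x , xs , p) → x Vector.∷ xs , p)
       (λ (xs , p) → Vector.head xs , Vector.tail xs , resp head∷tail p)
       (anyᴬ? λ x → anyVector? anyᴬ? k (λ xs → P? (x Vector.∷ xs))
                      (λ xs≗ys → resp λ { zero → refl ; (suc i) → xs≗ys i }))
  where
  head∷tail : ∀ {xs} → xs ≗ Vector.head xs Vector.∷ Vector.tail xs
  head∷tail zero = refl
  head∷tail (suc i) = refl

module _ {n : ℕ} (G : Graph n) where

  Adjacent⇒¬NonAdjacent : ∀ {x y} → Adjacent G x y → ¬ NonAdjacent G x y
  Adjacent⇒¬NonAdjacent x~y x≁y with () ← trans (sym x~y) x≁y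

  NonAdjacent-sym : ∀ {x y} → NonAdjacent G x y → NonAdjacent G y x
  NonAdjacent-sym {x} {y} x≁y = trans (Graph.sym G y x) x≁y

  -- Includes v itself, as the adjacency relation is irreflexive.
  nonNeighbours : Fin n → Subset n
  nonNeighbours v = tabulate (λ w → not (adj G v w))

  ∈-nonNeighbours⁺ : ∀ {v w} → NonAdjacent G v w → w ∈ nonNeighbours v
  ∈-nonNeighbours⁺ v≁w = x∈tabulate⁺ (cong not v≁w)

  ∈-nonNeighbours⁻ : ∀ {v w} → w ∈ nonNeighbours v → NonAdjacent G v w
  ∈-nonNeighbours⁻ w∈ = not-injective (x∈tabulate⁻ w∈)

  ¬Universal⇒nonNeighbour : ∀ {v} → ¬ Universal G v → ∃ λ w → w ≢ v × NonAdjacent G v w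
  ¬Universal⇒nonNeighbour {v} ¬univ
    with w , ¬[w≢v⇒v~w] ← ¬∀⟶∃¬ n _ (λ w → ¬? (w ≟ v) →-dec adj G v w ≟ᵇ _) ¬univ
    = w , (λ w≡v → ¬[w≢v⇒v~w] λ w≢v → contradiction w≡v w≢v)
        , ¬-not (λ v~w → ¬[w≢v⇒v~w] λ _ → v~w)

  Covers : ∀ {k} → (Fin k → Subset n) → Set
  Covers N = ∀ x y → x ≢ y → NonAdjacent G x y → ∃ λ i → x ∈ N i × y ∈ N i

  IsCover : ∀ {k} → (Fin k → Subset n) → Set
  IsCover N = (∀ i → IsIndependent G (N i)) × Covers N

  IsCover? : ∀ {k} → Decidable (IsCover {k})
  IsCover? N =
    all? (λ i → all? λ x → all? λ y → x ∈? N i →-dec (y ∈? N i →-dec nonAdjacent? x y))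
    ×-dec
    all? (λ x → all? λ y → ¬? (x ≟ y) →-dec (nonAdjacent? x y →-dec
           any? λ i → x ∈? N i ×-dec y ∈? N i))
    where
    nonAdjacent? : ∀ x y → Dec (NonAdjacent G x y)
    nonAdjacent? x y = adj G x y ≟ᵇ _

  IsCover-resp-≗ : ∀ {k} → IsCover {k} Respects _≗_
  IsCover-resp-≗ {x = N} {M} N≗M (independent , covers) =
    (λ i x y x∈ y∈ → independent i x y (subst (x ∈_) (sym (N≗M i)) x∈)
                                       (subst (y ∈_) (sym (N≗M i)) y∈))
    , λ x y x≢y x≁y → let (i , x∈ , y∈) = covers x y x≢y x≁y
                       in i , subst (x ∈_) (N≗M i) x∈ , subst (y ∈_) (N≗M i) y∈

  CompleteWidthCover? : ∀ k → Dec (CompleteWidthCover G k)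
  CompleteWidthCover? k = anyVector? anySubset? k IsCover? IsCover-resp-≗

  completeWidth≡m⊎1+m : ∀ {m} → (∀ j → CompleteWidthCover G j → m ≤ j) →
                        CompleteWidthCover G (suc m) →
                        ∃ λ k → IsCompleteWidth G k × (k ≡ m ⊎ k ≡ suc m)
  completeWidth≡m⊎1+m {m} m≤ cover₁₊ₘ with CompleteWidthCover? m
  ... | yes coverₘ = m , (coverₘ , λ j j<m coverⱼ → <⇒≱ j<m (m≤ j coverⱼ)) , inj₁ refl
  ... | no ¬coverₘ = suc m , (cover₁₊ₘ , λ j j<1+m coverⱼ →
          ¬coverₘ (subst (CompleteWidthCover G) (≤-antisym (s≤s⁻¹ j<1+m) (m≤ j coverⱼ)) coverⱼ))
        , inj₂ refl

  cliqueSize≤coverSize : ∀ {Q j} → IsClique G Q → (∀ q → q ∈ Q → ¬ Universal G q) →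
                         CompleteWidthCover G j → ∣ Q ∣ ≤ j
  cliqueSize≤coverSize {Q} clique ¬univ (N , independent , covers) = ≮⇒≥ λ j<∣Q∣ →
    let (a , b , a<b , same) = pigeonhole j<∣Q∣ (proj₁ ∘ coveredBy) in
    Adjacent⇒¬NonAdjacent
      (clique _ _ (enumerate-∈ Q a) (enumerate-∈ Q b) (<⇒≢ a<b ∘ enumerate-injective Q))
      (independent _ _ _ (proj₂ (coveredBy a))
                         (subst (λ i → enumerate Q b ∈ N i) (sym same) (proj₂ (coveredBy b))))
    where
    coveredBy : ∀ a → ∃ λ i → enumerate Q a ∈ N i
    coveredBy a with w , w≢q , q≁w ← ¬Universal⇒nonNeighbour (¬univ _ (enumerate-∈ Q a))
                  with i , q∈ , _ ← covers _ w (≢-sym w≢q) q≁w = i , q∈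

module _ {n : ℕ} (G : Graph n) {Q : Subset n} (split : IsSplitPartition G Q) where

  private
    clique = proj₁ split
    stable = proj₂ split

  ∁-independent : IsIndependent G (∁ Q)
  ∁-independent x y x∈ y∈ = stable x y (x∈∁p⇒x∉p x∈) (x∈∁p⇒x∉p y∈)

  nonNeighbours-independent : ∀ {q} → q ∈ Q → IsIndependent G (nonNeighbours G q)
  nonNeighbours-independent {q} q∈Q x y x∈ y∈ with x ≟ q | y ≟ q
  ... | yes refl | _ = ∈-nonNeighbours⁻ G y∈
  ... | no _ | yes refl = NonAdjacent-sym G (∈-nonNeighbours⁻ G x∈)
  ... | no x≢q | no y≢q = stable x y (outside-Q x≢q x∈) (outside-Q y≢q y∈)
    where
    outside-Q : ∀ {w} → w ≢ q → w ∈ nonNeighbours G q → w ∉ Q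
    outside-Q w≢q w∈ w∈Q =
      Adjacent⇒¬NonAdjacent G (clique q _ q∈Q w∈Q (≢-sym w≢q)) (∈-nonNeighbours⁻ G w∈)

  splitCover : CompleteWidthCover G (suc ∣ Q ∣)
  splitCover = N , independent , covers
    where
    N : Fin (suc ∣ Q ∣) → Subset n
    N = ∁ Q Vector.∷ (nonNeighbours G ∘ enumerate Q)

    independent : ∀ i → IsIndependent G (N i)
    independent zero = ∁-independent
    independent (suc i) = nonNeighbours-independent (enumerate-∈ Q i)

    coversQ∁ : ∀ {q s} → q ∈ Q → s ∉ Q → NonAdjacent G q s → ∃ λ i → q ∈ N i × s ∈ N i
    coversQ∁ q∈Q s∉Q q≁s with i , refl ← enumerate-surjective Q q∈Q =
      suc i , ∈-nonNeighbours⁺ G (irrefl G _) , ∈-nonNeighbours⁺ G q≁s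

    covers : Covers G N
    covers x y x≢y x≁y with x ∈? Q | y ∈? Q
    ... | yes x∈Q | yes y∈Q = contradiction x≁y (Adjacent⇒¬NonAdjacent G (clique x y x∈Q y∈Q x≢y))
    ... | yes x∈Q | no y∉Q = coversQ∁ x∈Q y∉Q x≁y
    ... | no x∉Q | yes y∈Q
      with i , y∈ , x∈ ← coversQ∁ y∈Q x∉Q (NonAdjacent-sym G x≁y) = i , x∈ , y∈
    ... | no x∉Q | no y∉Q = zero , x∉p⇒x∈∁p x∉Q , x∉p⇒x∈∁p y∉Q

theorem6 : (n : ℕ) (G : Graph n) (Q : Subset n) →
    IsSplitPartition G Q →
    (∀ v → ¬ Universal G v) →
    Σ ℕ λ k → IsCompleteWidth G k × (k ≡ ∣ Q ∣ ⊎ k ≡ suc ∣ Q ∣)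
theorem6 n G Q split ¬univ =
  completeWidth≡m⊎1+m G (λ j → cliqueSize≤coverSize G (proj₁ split) (λ q _ → ¬univ q))
                        (splitCover G split)
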